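{- Let $F$ be a graph whose vertex set is partitioned as $V(F)=S\cup R$ with $R\neq\emptyset$. Suppose that (i) every vertex of $R$ has at least $3|R|$ neighbors in $S$; (ii) any two vertices $u,v\in N(R,S)$ have at least $6|R|$ common neighbors in $S$; and (iii) any three vertices $u,v,w\in N(N(R,S),S)$ have at least $7|R|$ common neighbors in $S$. Then $F$ contains a ladder whose vertex set consists of $R$ together with $7|R|-2$ further vertices from $S$.
   Context: For $U,S\subseteq V(F)$, $N(U,S)=\bigcup_{u\in U}\Gamma(u,S)$, where $\Gamma(u,S)$ is the set of neighbors of $u$ in $S$. A ladder is a graph isomorphic to some $n$-ladder $L_n$: the bipartite graph with parts $\{a_1,\dots,a_n\}$ and $\{b_1,\dots,b_n\}$ in which $a_i\sim b_j$ iff $|i-j|\le 1$; "$F$ contains a ladder" means $F$ has a subgraph isomorphic to some $L_n$. -}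

module Defs where

open import Data.Nat using (ℕ; suc; _≤_)
open import Data.Bool using (Bool; true; false; _∧_)
open import Data.Fin using (Fin; toℕ)
open import Data.Fin.Subset using (Subset; _∈_)
open import Data.Vec using (tabulate; lookup)
open import Data.Sum using (_⊎_; inj₁; inj₂)
open import Data.Product using (Σ; ∃; _×_; _,_)
open import Data.Empty renaming (⊥ to False)
open import Relation.Binary.PropositionalEquality using (_≡_; _≢_)
open import Function.Definitions using (Injective)

record Graph (n : ℕ) : Set where
  field
    adj     : Fin n → Fin n → Bool
    sym     : ∀ u v → adj u v ≡ adj v u
    irrefl  : ∀ u → adj u u ≡ false

open Graph public

_∼[_]_ : ∀ {n} → Fin n → Graph n → Fin n → Set
u ∼[ F ] v = adj F u v ≡ true

Γ : ∀ {n} → Graph n → Fin n → Subset n → Subset n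
Γ F u S = tabulate (λ v → adj F u v ∧ lookup S v)

-- N(U,S) = ⋃_{u ∈ U} Γ(u,S), as a membership predicate on vertices
-- (U given as a predicate so that N can be iterated: N(N(R,S),S)).
N : ∀ {n} → Graph n → (Fin n → Set) → Subset n → Fin n → Set
N F U S v = ∃ λ u → U u × v ∈ Γ F u S

-- The n-ladder L_m: vertices a_i = inj₁ i, b_j = inj₂ j (i,j : Fin m),
-- with a_i ∼ b_j iff |i - j| ≤ 1 (and no other edges).
Close : ∀ {m} → Fin m → Fin m → Set
Close i j = (toℕ i ≤ suc (toℕ j)) × (toℕ j ≤ suc (toℕ i))

LadderEdge : (m : ℕ) → Fin m ⊎ Fin m → Fin m ⊎ Fin m → Set
LadderEdge m (inj₁ i) (inj₂ j) = Close i j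
LadderEdge m (inj₂ j) (inj₁ i) = Close i j
LadderEdge m (inj₁ _) (inj₁ _) = False
LadderEdge m (inj₂ _) (inj₂ _) = False

LadderEmbedding : ∀ {n} → Graph n → (m : ℕ) → (Fin m ⊎ Fin m → Fin n) → Set
LadderEmbedding F m φ =
  Injective _≡_ _≡_ φ × (∀ x y → LadderEdge m x y → φ x ∼[ F ] φ y)

InImage : ∀ {n m} → (Fin m ⊎ Fin m → Fin n) → Fin n → Set
InImage φ v = ∃ λ x → φ x ≡ v

-- List R as r₀, …, r_{k}.  The ladder is built from blocks, one per rᵢ:
--
--   (a₁⁰, x₀) (r₀, y₀) (a₃⁰, z₀)  (a₄¹, b¹) (a₁¹, x₁) (r₁, y₁) (a₃¹, z₁)  (a₄², b²) …
--
-- where xᵢ, yᵢ, zᵢ are neighbours of rᵢ in S, each a-vertex is a common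
-- neighbour of two consecutive vertices of the sequence x₀ y₀ z₀ x₁ y₁ z₁ …,
-- and bⁱ is a common neighbour of a₃ⁱ⁻¹, a₄ⁱ and a₁ⁱ.  All these vertices are
-- chosen distinct by a greedy procedure, in three rounds (first all x, y, z,
-- then all a, then all b): a round asking for m new vertices on top of u used
-- ones succeeds as soon as every requested set has at least u + m elements.
-- The rounds ask for 3|R|, 3|R| - 1 and |R| - 1 vertices, so hypotheses (i),
-- (ii), (iii) give exactly the budgets 3|R|, 6|R| and 7|R| they need, and
-- 3|R| + (3|R| - 1) + (|R| - 1) = 7|R| - 2.
module Submission where

open import Defs
open import Data.Nat using (ℕ; _*_; _∸_; _≥_)
open import Data.Fin using (Fin)
open import Data.Fin.Subset using (Subset; _∈_; _∩_; _∪_; ⊥; ⊤; ∣_∣; Nonempty; _⊆_)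
open import Data.Sum using (_⊎_)
open import Data.Product using (Σ; ∃; _×_)
open import Relation.Binary.PropositionalEquality using (_≡_; _≢_)
open import Function.Bundles using (_⇔_)

open import Data.Nat using (zero; suc; pred; _+_; _≤_; _<_; z≤n; s≤s; s≤s⁻¹)
open import Data.Nat.Properties
  using (≤-refl; ≤-trans; ≤-reflexive; <-≤-trans; m≤m+n; m≤n+m; m+n≤o⇒m≤o;
         +-suc; +-assoc; *-suc; +-monoˡ-≤; 1+n≰n; m+n∸m≡n;
         +-commutativeSemigroup)
open import Data.Nat.Tactic.RingSolver using (solve-∀)
open import Algebra.Properties.CommutativeSemigroup +-commutativeSemigroup using (x∙yz≈y∙xz)
open import Data.Bool using (Bool; true; false; _∧_)
open import Data.Fin using (zero; suc)
open import Data.Fin.Subset.Properties using (x∈p∩q⁻; x∈p∩q⁺; ∉⊥; _∈?_; ⊆-antisym)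
open import Data.Vec using ([]; _∷_; lookup; here; there)
open import Data.Vec.Properties using ([]=⇒lookup; lookup⇒[]=; lookup∘tabulate)
open import Data.List using (List; []; _∷_; _++_; length; filter; allFin)
open import Data.List.Properties using (length-++)
open import Data.List.Relation.Unary.All using (All; []; _∷_)
open import Data.List.Relation.Unary.Any using (here; there)
open import Data.List.Membership.Propositional using () renaming (_∈_ to _∈ₗ_; _∉_ to _∉ₗ_)
open import Data.List.Membership.Propositional.Properties
  using (++-∈⇔; ∈-filter⁺; ∈-filter⁻; ∈-allFin)
open import Data.List.Relation.Unary.Unique.Propositional using (Unique; []; _∷_)
import Data.List.Relation.Unary.Unique.Propositional.Properties as Unique
import Data.List.Relation.Unary.All as All
open import Data.List.Relation.Unary.All.Properties using (++⁺)
open import Data.List.Relation.Binary.Pointwise using (Pointwise; []; _∷_; Pointwise-length)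
open import Data.Product using (_,_; proj₁; proj₂)
open import Data.Sum using (inj₁; inj₂)
import Data.Sum as Sum
open import Data.Sum.Function.Propositional using (_⊎-⇔_)
open import Data.Empty using (⊥-elim) renaming (⊥ to False)
open import Relation.Binary.PropositionalEquality using (refl; trans; cong; cong₂; subst)
import Relation.Binary.PropositionalEquality as ≡
open import Function.Bundles using (mk⇔; Equivalence)
open import Function.Construct.Composition using (_⇔-∘_)

private
  variable
    n : ℕ
    u v x y : Fin n
    xs ys : List (Fin n)

δ : Fin n → Fin n → ℕ
δ zero    zero    = 1
δ zero    (suc _) = 0
δ (suc _) zero    = 0
δ (suc a) (suc b) = δ a b

δ-refl : (v : Fin n) → δ v v ≡ 1
δ-refl zero    = refl
δ-refl (suc v) = δ-refl v

δ≤1 : (v x : Fin n) → δ v x ≤ 1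
δ≤1 zero    zero    = ≤-refl
δ≤1 zero    (suc _) = z≤n
δ≤1 (suc _) zero    = z≤n
δ≤1 (suc v) (suc x) = δ≤1 v x

δ-≡ : 1 ≤ δ v x → v ≡ x
δ-≡ {v = zero}  {zero}  _ = refl
δ-≡ {v = suc v} {suc x} p = cong suc (δ-≡ p)

-- occ v xs is the number of occurrences of v in xs; lists of vertices are
-- compared as multisets through it.
occ : Fin n → List (Fin n) → ℕ
occ v []       = 0
occ v (x ∷ xs) = δ v x + occ v xs

record Distinct (xs : List (Fin n)) : Set where
  constructor distinct
  field at-most-once : ∀ v → occ v xs ≤ 1
open Distinct

positive-sum : ∀ a b → 1 ≤ a + b → 1 ≤ a ⊎ 1 ≤ b
positive-sum zero    b p = inj₂ p
positive-sum (suc a) b _ = inj₁ (s≤s z≤n)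

sum≤1 : ∀ {a b} → a ≤ 1 → b ≤ 1 → (1 ≤ a → 1 ≤ b → False) → a + b ≤ 1
sum≤1 {zero}                 _        b≤1 _     = b≤1
sum≤1 {suc zero}    {zero}   _        _   _     = ≤-refl
sum≤1 {suc zero}    {suc b}  _        _   apart = ⊥-elim (apart (s≤s z≤n) (s≤s z≤n))
sum≤1 {suc (suc a)}          (s≤s ()) _   _

occ-∈ : v ∈ₗ xs → 1 ≤ occ v xs
occ-∈ {v = v}              (here refl) rewrite δ-refl v = s≤s z≤n
occ-∈ {v = v} {xs = x ∷ _} (there p)   = ≤-trans (occ-∈ p) (m≤n+m _ (δ v x))

∈-occ : 1 ≤ occ v xs → v ∈ₗ xs
∈-occ {v = v} {x ∷ xs} p with positive-sum (δ v x) (occ v xs) p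
... | inj₁ q = here (δ-≡ q)
... | inj₂ q = there (∈-occ q)

∉-occ : occ v xs ≡ 0 → v ∉ₗ xs
∉-occ v∉ v∈ with () ← subst (1 ≤_) v∉ (occ-∈ v∈)

occ-++ : (v : Fin n) (xs ys : List (Fin n)) → occ v (xs ++ ys) ≡ occ v xs + occ v ys
occ-++ v []       ys = refl
occ-++ v (x ∷ xs) ys = trans (cong (δ v x +_) (occ-++ v xs ys)) (≡.sym (+-assoc (δ v x) _ _))

occ-++³ : (v : Fin n) (ws xs ys zs : List (Fin n)) →
          occ v (ws ++ xs ++ ys ++ zs) ≡ occ v ws + (occ v xs + (occ v ys + occ v zs))
occ-++³ v ws xs ys zs =
  trans (occ-++ v ws _)
        (cong (occ v ws +_) (trans (occ-++ v xs _) (cong (occ v xs +_) (occ-++ v ys zs))))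

occ-move : (xs : List (Fin n)) → occ v (xs ++ x ∷ ys) ≡ occ v (x ∷ xs ++ ys)
occ-move             []       = refl
occ-move {v = v} {x} (y ∷ xs) =
  trans (cong (δ v y +_) (occ-move xs)) (x∙yz≈y∙xz (δ v y) (δ v x) _)

infix 4 _≈ₘ_
_≈ₘ_ : List (Fin n) → List (Fin n) → Set
xs ≈ₘ ys = ∀ v → occ v xs ≡ occ v ys

≈ₘ-∈ : xs ≈ₘ ys → v ∈ₗ xs ⇔ v ∈ₗ ys
≈ₘ-∈ {v = v} eq = mk⇔ (λ p → ∈-occ (subst (1 ≤_) (eq v) (occ-∈ p)))
                      (λ p → ∈-occ (subst (1 ≤_) (≡.sym (eq v)) (occ-∈ p)))

≈ₘ-distinct : xs ≈ₘ ys → Distinct ys → Distinct xs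
≈ₘ-distinct eq d = distinct λ v → subst (_≤ 1) (≡.sym (eq v)) (at-most-once d v)

distinct-∷ : x ∉ₗ xs → Distinct xs → Distinct (x ∷ xs)
distinct-∷ {x = x} {xs} x∉ d = distinct λ v →
  sum≤1 (δ≤1 v x) (at-most-once d v) (λ v≡x v∈ → x∉ (subst (_∈ₗ xs) (δ-≡ v≡x) (∈-occ v∈)))

distinct-head : Distinct (x ∷ xs) → x ∉ₗ xs
distinct-head {x = x} {xs} d x∈ =
  1+n≰n (≤-trans (s≤s (occ-∈ x∈)) (subst (λ k → k + occ x xs ≤ 1) (δ-refl x) (at-most-once d x)))

distinct-≢ : Distinct (x ∷ xs) → y ∈ₗ xs → x ≢ y
distinct-≢ d y∈ refl = distinct-head d y∈

distinct-tail : Distinct (x ∷ xs) → Distinct xs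
distinct-tail {x = x} {xs} d = distinct λ v → ≤-trans (m≤n+m (occ v xs) (δ v x)) (at-most-once d v)

distinct-++ˡ : Distinct (xs ++ ys) → Distinct xs
distinct-++ˡ {xs = xs} d = distinct λ v →
  ≤-trans (m≤m+n _ _) (subst (_≤ 1) (occ-++ v xs _) (at-most-once d v))

distinct-++ : Distinct xs → Distinct ys → (∀ {v} → v ∈ₗ xs → v ∈ₗ ys → False) →
              Distinct (xs ++ ys)
distinct-++ {xs = xs} dx dy apart = distinct λ v →
  subst (_≤ 1) (≡.sym (occ-++ v xs _))
        (sum≤1 (at-most-once dx v) (at-most-once dy v) (λ p q → apart (∈-occ p) (∈-occ q)))

unshift : List (Fin (suc n)) → List (Fin n)
unshift []           = []
unshift (zero  ∷ xs) = unshift xs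
unshift (suc x ∷ xs) = x ∷ unshift xs

occ-unshift : (v : Fin n) (xs : List (Fin (suc n))) → occ (suc v) xs ≡ occ v (unshift xs)
occ-unshift v []           = refl
occ-unshift v (zero  ∷ xs) = occ-unshift v xs
occ-unshift v (suc x ∷ xs) = cong (δ v x +_) (occ-unshift v xs)

length-unshift : (xs : List (Fin (suc n))) → length xs ≡ occ zero xs + length (unshift xs)
length-unshift []           = refl
length-unshift (zero  ∷ xs) = cong suc (length-unshift xs)
length-unshift (suc x ∷ xs) = trans (cong suc (length-unshift xs)) (≡.sym (+-suc _ _))

unshift-≤ : (xs : List (Fin (suc n))) → length (unshift xs) ≤ length xs
unshift-≤ xs =
  subst (length (unshift xs) ≤_) (≡.sym (length-unshift xs)) (m≤n+m _ (occ zero xs))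

unshift-< : (xs : List (Fin (suc n))) → 1 ≤ occ zero xs → length (unshift xs) < length xs
unshift-< xs p =
  subst (length (unshift xs) <_) (≡.sym (length-unshift xs)) (+-monoˡ-≤ (length (unshift xs)) p)

distinct-unshift : (xs : List (Fin (suc n))) → Distinct xs → Distinct (unshift xs)
distinct-unshift xs d = distinct λ v → subst (_≤ 1) (occ-unshift v xs) (at-most-once d (suc v))

fresh : (A : Subset n) (U : List (Fin n)) → length U < ∣ A ∣ → ∃ λ x → x ∈ A × occ x U ≡ 0
fresh {suc n} (true ∷ A) U |U|<|A| with occ zero U in eq
... | zero  = zero , here , eq
... | suc _ = shift (fresh A (unshift U) (<-≤-trans (unshift-< U zero∈U) (s≤s⁻¹ |U|<|A|)))
  where
  zero∈U : 1 ≤ occ zero U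
  zero∈U = subst (1 ≤_) (≡.sym eq) (s≤s z≤n)
  shift : ∃ (λ x → x ∈ A × occ x (unshift U) ≡ 0) → ∃ λ x → x ∈ true ∷ A × occ x U ≡ 0
  shift (x , x∈A , x∉U) = suc x , there x∈A , trans (occ-unshift x U) x∉U
fresh {suc n} (false ∷ A) U |U|<|A| with fresh A (unshift U) (<-≤-trans (s≤s (unshift-≤ U)) |U|<|A|)
... | x , x∈A , x∉U = suc x , there x∈A , trans (occ-unshift x U) x∉U

positive : ℕ → Bool
positive zero    = false
positive (suc _) = true

support : List (Fin n) → Subset n
support {zero}  _  = []
support {suc n} xs = positive (occ zero xs) ∷ support (unshift xs)

support⁺ : (v : Fin n) (xs : List (Fin n)) → 1 ≤ occ v xs → v ∈ support xs
support⁺ zero    xs p with occ zero xs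
... | suc _ = here
support⁺ (suc v) xs p = there (support⁺ v (unshift xs) (subst (1 ≤_) (occ-unshift v xs) p))

support⁻ : (v : Fin n) (xs : List (Fin n)) → v ∈ support xs → 1 ≤ occ v xs
support⁻ zero    xs p with occ zero xs
support⁻ zero    xs () | zero
...                    | suc _ = s≤s z≤n
support⁻ (suc v) xs (there p) = subst (1 ≤_) (≡.sym (occ-unshift v xs)) (support⁻ v (unshift xs) p)

support-∈ : (xs : List (Fin n)) (v : Fin n) → v ∈ₗ xs ⇔ v ∈ support xs
support-∈ xs v = mk⇔ (λ p → support⁺ v xs (occ-∈ p)) (λ p → ∈-occ (support⁻ v xs p))

∣support∣ : (xs : List (Fin n)) → Distinct xs → ∣ support xs ∣ ≡ length xs
∣support∣ {zero}  []       _ = refl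
∣support∣ {zero}  (() ∷ _) _
∣support∣ {suc n} xs d with occ zero xs in eq | at-most-once d zero
... | zero        | _      = trans (∣support∣ (unshift xs) (distinct-unshift xs d)) (≡.sym split)
  where split = trans (length-unshift xs) (cong (_+ length (unshift xs)) eq)
... | suc zero    | _      =
  trans (cong suc (∣support∣ (unshift xs) (distinct-unshift xs d))) (≡.sym split)
  where split = trans (length-unshift xs) (cong (_+ length (unshift xs)) eq)
... | suc (suc _) | s≤s ()

elements : Subset n → List (Fin n)
elements p = filter (_∈? p) (allFin _)

elements-∈ : (p : Subset n) (v : Fin n) → v ∈ₗ elements p ⇔ v ∈ p
elements-∈ {n} p v =
  mk⇔ (λ q → proj₂ (∈-filter⁻ (_∈? p) {xs = allFin n} q)) (∈-filter⁺ (_∈? p) (∈-allFin v))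

unique⇒distinct : Unique xs → Distinct xs
unique⇒distinct []           = distinct λ _ → z≤n
unique⇒distinct (x≢xs ∷ u) = distinct-∷ (λ x∈ → All.lookup x≢xs x∈ refl) (unique⇒distinct u)

elements-distinct : (p : Subset n) → Distinct (elements p)
elements-distinct {n} p = unique⇒distinct (Unique.filter⁺ (_∈? p) (Unique.allFin⁺ n))

elements-size : (p : Subset n) → length (elements p) ≡ ∣ p ∣
elements-size p = trans (≡.sym (∣support∣ (elements p) (elements-distinct p))) (cong ∣_∣ support≡p)
  where
  support≡p : support (elements p) ≡ p
  support≡p = ⊆-antisym
    (λ {v} q → Equivalence.to (elements-∈ p v) (Equivalence.from (support-∈ _ v) q))
    (λ {v} q → Equivalence.to (support-∈ _ v) (Equivalence.from (elements-∈ p v) q))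

Γ-member : (F : Graph n) {S : Subset n} → v ∈ Γ F u S → u ∼[ F ] v × v ∈ S
Γ-member {v = v} {u} F {S} v∈ with adj F u v | lookup S v in eq | lookup-Γ
  where
  lookup-Γ : (adj F u v ∧ lookup S v) ≡ true
  lookup-Γ = trans (≡.sym (lookup∘tabulate (λ w → adj F u w ∧ lookup S w) v)) ([]=⇒lookup v∈)
... | true | true | _ = refl , lookup⇒[]= v S eq

∼-sym : (F : Graph n) → u ∼[ F ] v → v ∼[ F ] u
∼-sym {u = u} {v} F e = trans (Graph.sym F v u) e

N-⊆ : (F : Graph n) {U : Fin n → Set} {S : Subset n} → N F U S v → v ∈ S
N-⊆ F (_ , _ , v∈) = proj₂ (Γ-member F v∈)

-- A ladder given by its list of rungs (a₁,b₁) … (a_m,b_m), and the embedding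
-- of L_m it defines.
module Ladders {n} (F : Graph n) where

  Rung : Set
  Rung = Fin n × Fin n

  _∼_ : Fin n → Fin n → Set
  u ∼ v = u ∼[ F ] v

  data IsLadder : List Rung → Set where
    last : ∀ {a b} → a ∼ b → IsLadder ((a , b) ∷ [])
    step : ∀ {a b a′ b′ ps} → a ∼ b → a ∼ b′ → a′ ∼ b →
           IsLadder ((a′ , b′) ∷ ps) → IsLadder ((a , b) ∷ (a′ , b′) ∷ ps)

  vertices : List Rung → List (Fin n)
  vertices []             = []
  vertices ((a , b) ∷ ps) = a ∷ b ∷ vertices ps

  embed : (ps : List Rung) → Fin (length ps) ⊎ Fin (length ps) → Fin n
  embed ((a , _) ∷ _)  (inj₁ zero)    = a
  embed ((_ , b) ∷ _)  (inj₂ zero)    = b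
  embed (_ ∷ ps)       (inj₁ (suc i)) = embed ps (inj₁ i)
  embed (_ ∷ ps)       (inj₂ (suc j)) = embed ps (inj₂ j)

  embed-edge : ∀ {ps} → IsLadder ps → (i j : Fin (length ps)) → Close i j →
               embed ps (inj₁ i) ∼ embed ps (inj₂ j)
  embed-edge (last e)       zero          zero          _       = e
  embed-edge (last _)       zero          (suc ())      _
  embed-edge (last _)       (suc ())      _             _
  embed-edge (step e _ _ _) zero          zero          _       = e
  embed-edge (step _ e _ _) zero          (suc zero)    _       = e
  embed-edge (step _ _ e _) (suc zero)    zero          _       = e
  embed-edge (step _ _ _ _) zero          (suc (suc _)) (_ , s≤s ())
  embed-edge (step _ _ _ _) (suc (suc _)) zero          (s≤s () , _)
  embed-edge (step _ _ _ l) (suc i)       (suc j)       (p , q) =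
    embed-edge l i j (s≤s⁻¹ p , s≤s⁻¹ q)

  embed-edges : ∀ {ps} → IsLadder ps → ∀ x y → LadderEdge (length ps) x y →
                embed ps x ∼ embed ps y
  embed-edges l (inj₁ i) (inj₂ j) c = embed-edge l i j c
  embed-edges l (inj₂ j) (inj₁ i) c = ∼-sym F (embed-edge l i j c)

  embed-∈ : (ps : List Rung) (x : Fin (length ps) ⊎ Fin (length ps)) → embed ps x ∈ₗ vertices ps
  embed-∈ (_ ∷ _)  (inj₁ zero)    = here refl
  embed-∈ (_ ∷ _)  (inj₂ zero)    = there (here refl)
  embed-∈ (_ ∷ ps) (inj₁ (suc i)) = there (there (embed-∈ ps (inj₁ i)))
  embed-∈ (_ ∷ ps) (inj₂ (suc j)) = there (there (embed-∈ ps (inj₂ j)))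

  ∈-embed : (ps : List Rung) {v : Fin n} → v ∈ₗ vertices ps → InImage (embed ps) v
  ∈-embed (_ ∷ _)  (here refl)         = inj₁ zero , refl
  ∈-embed (_ ∷ _)  (there (here refl)) = inj₂ zero , refl
  ∈-embed (_ ∷ ps) (there (there p)) with ∈-embed ps p
  ... | inj₁ i , e = inj₁ (suc i) , e
  ... | inj₂ j , e = inj₂ (suc j) , e

  embed-image : (ps : List Rung) (v : Fin n) → InImage (embed ps) v ⇔ v ∈ₗ vertices ps
  embed-image ps v = mk⇔ (λ { (x , refl) → embed-∈ ps x }) (∈-embed ps)

  data Position {m : ℕ} : Fin (suc m) ⊎ Fin (suc m) → Set where
    top₁  : Position (inj₁ zero)
    top₂  : Position (inj₂ zero)
    below : (x : Fin m ⊎ Fin m) → Position (Sum.map suc suc x)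

  position : ∀ {m} (x : Fin (suc m) ⊎ Fin (suc m)) → Position x
  position (inj₁ zero)    = top₁
  position (inj₂ zero)    = top₂
  position (inj₁ (suc i)) = below (inj₁ i)
  position (inj₂ (suc j)) = below (inj₂ j)

  embed-below : (p : Rung) (ps : List Rung) (x : Fin (length ps) ⊎ Fin (length ps)) →
                embed (p ∷ ps) (Sum.map suc suc x) ≡ embed ps x
  embed-below p ps (inj₁ i) = refl
  embed-below p ps (inj₂ j) = refl

  below-∈ : (p : Rung) (ps : List Rung) (x : Fin (length ps) ⊎ Fin (length ps)) →
            embed (p ∷ ps) (Sum.map suc suc x) ∈ₗ vertices ps
  below-∈ p ps x = subst (_∈ₗ vertices ps) (≡.sym (embed-below p ps x)) (embed-∈ ps x)

  embed-injective : (ps : List Rung) → Distinct (vertices ps) →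
                    ∀ {x y} → embed ps x ≡ embed ps y → x ≡ y
  embed-injective []             _ {inj₁ ()}
  embed-injective []             _ {inj₂ ()}
  embed-injective ((a , b) ∷ ps) d {x} {y} e with position x | position y
  ... | top₁     | top₁     = refl
  ... | top₂     | top₂     = refl
  ... | top₁     | top₂     = ⊥-elim (distinct-head d (here e))
  ... | top₂     | top₁     = ⊥-elim (distinct-head d (here (≡.sym e)))
  ... | top₁     | below y′ =
    ⊥-elim (distinct-head d (there (subst (_∈ₗ _) (≡.sym e) (below-∈ _ ps y′))))
  ... | below x′ | top₁     =
    ⊥-elim (distinct-head d (there (subst (_∈ₗ _) e (below-∈ _ ps x′))))
  ... | top₂     | below y′ =
    ⊥-elim (distinct-head (distinct-tail d) (subst (_∈ₗ _) (≡.sym e) (below-∈ _ ps y′)))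
  ... | below x′ | top₂     =
    ⊥-elim (distinct-head (distinct-tail d) (subst (_∈ₗ _) e (below-∈ _ ps x′)))
  ... | below x′ | below y′ = cong (Sum.map suc suc)
    (embed-injective ps (distinct-tail (distinct-tail d)) {x′} {y′}
      (trans (≡.sym (embed-below (a , b) ps x′)) (trans e (embed-below (a , b) ps y′))))

  ladder-embedding : ∀ {ps} → IsLadder ps → Distinct (vertices ps) →
                     LadderEmbedding F (length ps) (embed ps)
  ladder-embedding {ps} l d = embed-injective ps d , embed-edges l

record Round (As : List (Subset n)) (U : List (Fin n)) : Set where
  field
    picks  : List (Fin n)
    chosen : Pointwise _∈_ picks As
    new    : Distinct (picks ++ U)

shift-budget : ∀ u m {c} → u + suc m ≤ c → suc u + m ≤ c
shift-budget u m {c} = subst (_≤ c) (+-suc u m)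

-- The greedy choice never gets stuck when every requested set has at least
-- |U| + |As| elements.  Only this specification of the choice is ever used,
-- so the definition is kept opaque.
opaque
  greedy : (As : List (Subset n)) (U : List (Fin n)) → Distinct U →
           All (λ A → length U + length As ≤ ∣ A ∣) As → Round As U
  greedy []       U dU _            = record { picks = [] ; chosen = [] ; new = dU }
  greedy (A ∷ As) U dU (big ∷ bigs)
    with fresh A U (m+n≤o⇒m≤o (suc (length U)) (shift-budget (length U) (length As) big))
  ... | x , x∈A , x∉U = record { picks = x ∷ picks ; chosen = x∈A ∷ chosen ; new = moved }
    where
    open Round (greedy As (x ∷ U) (distinct-∷ (∉-occ x∉U) dU)
                       (All.map (shift-budget (length U) (length As)) bigs))
    moved : Distinct (x ∷ picks ++ U)
    moved = ≈ₘ-distinct (λ v → ≡.sym (occ-move picks)) new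

-- Arithmetic of the three rounds, for |R| = k + 1: round 1 chooses 3(k + 1)
-- vertices, round 2 one fewer, round 3 chooses k.
pred-3* : ∀ k → pred (3 * suc k) ≡ 2 + 3 * k
pred-3* = unfolded
  where
  unfolded : ∀ k → k + (suc k + (suc k + 0)) ≡ 2 + 3 * k
  unfolded = solve-∀

-- Round 2 comes after 3|R| choices and makes 3|R| - 1 more.
budget₂ : ∀ k {K} → suc k ≡ K → 3 * suc k + (2 + 3 * k) ≤ 6 * K
budget₂ k refl = m+n≤o⇒m≤o _ (≤-reflexive (total k))
  where
  total : ∀ k → 3 * suc k + (2 + 3 * k) + 1 ≡ 6 * suc k
  total = solve-∀

-- Round 3 comes after 6|R| - 1 choices and makes |R| - 1 more.
budget₃ : ∀ k {K} → suc k ≡ K → (2 + 3 * k) + 3 * suc k + k ≤ 7 * K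
budget₃ k refl = m+n≤o⇒m≤o _ (≤-reflexive (total k))
  where
  total : ∀ k → (2 + 3 * k) + 3 * suc k + k + 2 ≡ 7 * suc k
  total = solve-∀

picks-count : ∀ k → k + ((2 + 3 * k) + 3 * suc k) ≡ 7 * suc k ∸ 2
picks-count k = trans (≡.sym (m+n∸m≡n 2 _)) (cong (_∸ 2) (total k))
  where
  total : ∀ k → 2 + (k + ((2 + 3 * k) + 3 * suc k)) ≡ 7 * suc k
  total = solve-∀

first-block-count : ∀ a₁ x r y a₃ z R B A X →
  a₁ + (x + (r + (y + (a₃ + (z + (R + (B + (A + X)))))))) ≡
  (r + R) + (B + ((a₁ + (a₃ + A)) + (x + (y + (z + X)))))
first-block-count = solve-∀

later-block-count : ∀ a₄ b a₁ x r y a₃ z R B A X →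
  a₄ + (b + (a₁ + (x + (r + (y + (a₃ + (z + (R + (B + (A + X)))))))))) ≡
  (r + R) + ((b + B) + ((a₄ + (a₁ + (a₃ + A))) + (x + (y + (z + X)))))
later-block-count = solve-∀

module Construction {n} (F : Graph n) (S R : Subset n)
  (degree    : ∀ r → r ∈ R → ∣ Γ F r S ∣ ≥ 3 * ∣ R ∣)
  (codegree₂ : ∀ u v → N F (_∈ R) S u → N F (_∈ R) S v → u ≢ v →
               ∣ Γ F u S ∩ Γ F v S ∣ ≥ 6 * ∣ R ∣)
  (codegree₃ : ∀ u v w → N F (N F (_∈ R) S) S u → N F (N F (_∈ R) S) S v →
               N F (N F (_∈ R) S) S w → u ≢ v → u ≢ w → v ≢ w →
               ∣ Γ F u S ∩ Γ F v S ∩ Γ F w S ∣ ≥ 7 * ∣ R ∣)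
  where

  open Ladders F

  V : Set
  V = Fin n

  G : V → Subset n
  G u = Γ F u S

  N₁ N₂ : V → Set
  N₁ = N F (_∈ R) S
  N₂ = N F N₁ S

  edge : {u v : V} → v ∈ G u → u ∼ v
  edge v∈ = proj₁ (Γ-member F {S} v∈)

  edge⁻ : {u v : V} → v ∈ G u → v ∼ u
  edge⁻ v∈ = ∼-sym F (edge v∈)

  ∩ˡ : {v : V} {p q : Subset n} → v ∈ p ∩ q → v ∈ p
  ∩ˡ {p = p} {q} m = proj₁ (x∈p∩q⁻ p q m)

  ∩ʳ : {v : V} {p q : Subset n} → v ∈ p ∩ q → v ∈ q
  ∩ʳ {p = p} {q} m = proj₂ (x∈p∩q⁻ p q m)

  neighbourhoods : List V → List (Subset n)
  neighbourhoods []       = []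
  neighbourhoods (r ∷ rs) = G r ∷ G r ∷ G r ∷ neighbourhoods rs

  -- Round 2 asks for a common neighbour of any two consecutive vertices of
  -- round 1; these are a₁⁰ a₃⁰ a₄¹ a₁¹ a₃¹ a₄² ….
  bridges : List V → List (Subset n)
  bridges []           = []
  bridges (_ ∷ [])     = []
  bridges (u ∷ v ∷ vs) = G u ∩ G v ∷ bridges (v ∷ vs)

  -- Round 3 asks for a common neighbour bⁱ of a₃ⁱ⁻¹, a₄ⁱ, a₁ⁱ.
  triples : List V → List (Subset n)
  triples (u ∷ v ∷ w ∷ as) = G u ∩ G v ∩ G w ∷ triples as
  triples _                = []

  -- The triples start after the first round-2 vertex a₁⁰.
  corners : List V → List (Subset n)
  corners []       = []
  corners (_ ∷ as) = triples as

  neighbourhoods-large : {rs : List V} → All (_∈ R) rs →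
                         All (λ A → 3 * ∣ R ∣ ≤ ∣ A ∣) (neighbourhoods rs)
  neighbourhoods-large []           = []
  neighbourhoods-large (r∈R ∷ rs∈R) = big ∷ big ∷ big ∷ neighbourhoods-large rs∈R
    where big = degree _ r∈R

  bridges-large : {xs : List V} → All N₁ xs → Distinct xs →
                  All (λ A → 6 * ∣ R ∣ ≤ ∣ A ∣) (bridges xs)
  bridges-large []                _ = []
  bridges-large (_ ∷ [])          _ = []
  bridges-large (nu ∷ nv ∷ nvs) d =
    codegree₂ _ _ nu nv (distinct-≢ d (here refl)) ∷ bridges-large (nv ∷ nvs) (distinct-tail d)

  triples-large : {as : List V} → All N₂ as → Distinct as →
                  All (λ A → 7 * ∣ R ∣ ≤ ∣ A ∣) (triples as)
  triples-large []                  _ = []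
  triples-large (_ ∷ [])            _ = []
  triples-large (_ ∷ _ ∷ [])        _ = []
  triples-large (nu ∷ nv ∷ nw ∷ ns) d =
    codegree₃ _ _ _ nu nv nw (distinct-≢ d (here refl)) (distinct-≢ d (there (here refl)))
              (distinct-≢ (distinct-tail d) (here refl))
    ∷ triples-large ns (distinct-tail (distinct-tail (distinct-tail d)))

  corners-large : {as : List V} → All N₂ as → Distinct as →
                  All (λ A → 7 * ∣ R ∣ ≤ ∣ A ∣) (corners as)
  corners-large []        _ = []
  corners-large (_ ∷ ns) d = triples-large ns (distinct-tail d)

  neighbourhoods-N₁ : {rs xs : List V} → All (_∈ R) rs →
                      Pointwise _∈_ xs (neighbourhoods rs) → All N₁ xs
  neighbourhoods-N₁ []           []                       = []
  neighbourhoods-N₁ (r∈R ∷ rs∈R) (x∈ ∷ y∈ ∷ z∈ ∷ chosen) =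
    (_ , r∈R , x∈) ∷ (_ , r∈R , y∈) ∷ (_ , r∈R , z∈) ∷ neighbourhoods-N₁ rs∈R chosen

  bridges-N₂ : {xs as : List V} → All N₁ xs → Pointwise _∈_ as (bridges xs) → All N₂ as
  bridges-N₂ []              []            = []
  bridges-N₂ (_ ∷ [])        []            = []
  bridges-N₂ (nu ∷ nv ∷ nvs) (a∈ ∷ chosen) = (_ , nu , ∩ˡ a∈) ∷ bridges-N₂ (nv ∷ nvs) chosen

  triples-S : (as : List V) {bs : List V} → Pointwise _∈_ bs (triples as) → All (_∈ S) bs
  triples-S (_ ∷ _ ∷ _ ∷ as) (b∈ ∷ chosen) = proj₂ (Γ-member F (∩ˡ b∈)) ∷ triples-S as chosen
  triples-S []               []            = []
  triples-S (_ ∷ [])         []            = []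
  triples-S (_ ∷ _ ∷ [])     []            = []

  corners-S : (as : List V) {bs : List V} → Pointwise _∈_ bs (corners as) → All (_∈ S) bs
  corners-S []       []     = []
  corners-S (_ ∷ as) chosen = triples-S as chosen

  length-neighbourhoods : (rs : List V) → length (neighbourhoods rs) ≡ 3 * length rs
  length-neighbourhoods []       = refl
  length-neighbourhoods (_ ∷ rs) =
    trans (cong (3 +_) (length-neighbourhoods rs)) (≡.sym (*-suc 3 (length rs)))

  length-bridges : (xs : List V) → length (bridges xs) ≡ pred (length xs)
  length-bridges []           = refl
  length-bridges (_ ∷ [])     = refl
  length-bridges (_ ∷ v ∷ vs) = cong suc (length-bridges (v ∷ vs))

  length-triples : {rs xs as : List V} {z a : V} →
                   Pointwise _∈_ xs (neighbourhoods rs) → Pointwise _∈_ as (bridges (z ∷ xs)) →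
                   length (triples (a ∷ as)) ≡ length rs
  length-triples {[]}    []                      []                        = refl
  length-triples {_ ∷ _} (_ ∷ _ ∷ _ ∷ chosen₁) (_ ∷ _ ∷ _ ∷ chosen₂) =
    cong suc (length-triples chosen₁ chosen₂)

  length-corners : {r : V} {rs xs as : List V} →
                   Pointwise _∈_ xs (neighbourhoods (r ∷ rs)) → Pointwise _∈_ as (bridges xs) →
                   length (corners as) ≡ length rs
  length-corners (_ ∷ _ ∷ _ ∷ chosen₁) (_ ∷ _ ∷ chosen₂) = length-triples chosen₁ chosen₂

  later-blocks : List V → List V → List V → List V → List Rung
  later-blocks (r ∷ rs) (x ∷ y ∷ z ∷ xs) (a₄ ∷ a₁ ∷ a₃ ∷ as) (b ∷ bs) =
    (a₄ , b) ∷ (a₁ , x) ∷ (r , y) ∷ (a₃ , z) ∷ later-blocks rs xs as bs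
  later-blocks _ _ _ _ = []

  ladder : List V → List V → List V → List V → List Rung
  ladder (r ∷ rs) (x ∷ y ∷ z ∷ xs) (a₁ ∷ a₃ ∷ as) bs =
    (a₁ , x) ∷ (r , y) ∷ (a₃ , z) ∷ later-blocks rs xs as bs
  ladder _ _ _ _ = []

  later-blocks-ladder : {rs xs as bs : List V} {a z : V} → a ∼ z →
    Pointwise _∈_ xs (neighbourhoods rs) → Pointwise _∈_ as (bridges (z ∷ xs)) →
    Pointwise _∈_ bs (triples (a ∷ as)) → IsLadder ((a , z) ∷ later-blocks rs xs as bs)
  later-blocks-ladder {[]}    a∼z [] [] [] = last a∼z
  later-blocks-ladder {_ ∷ _} a∼z (x∈ ∷ y∈ ∷ z∈ ∷ chosen₁) (a₄∈ ∷ a₁∈ ∷ a₃∈ ∷ chosen₂)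
                      (b∈ ∷ chosen₃) =
    step a∼z (edge (∩ˡ b∈)) (edge⁻ (∩ˡ a₄∈))
    (step (edge (∩ˡ (∩ʳ b∈))) (edge⁻ (∩ʳ a₄∈)) (edge (∩ʳ (∩ʳ b∈)))
    (step (edge⁻ (∩ˡ a₁∈)) (edge⁻ (∩ʳ a₁∈)) (edge x∈)
    (step (edge y∈) (edge z∈) (edge⁻ (∩ˡ a₃∈))
    (later-blocks-ladder (edge⁻ (∩ʳ a₃∈)) chosen₁ chosen₂ chosen₃))))

  ladder-is-ladder : {r : V} {rs xs as bs : List V} →
    Pointwise _∈_ xs (neighbourhoods (r ∷ rs)) → Pointwise _∈_ as (bridges xs) →
    Pointwise _∈_ bs (corners as) → IsLadder (ladder (r ∷ rs) xs as bs)
  ladder-is-ladder (x∈ ∷ y∈ ∷ z∈ ∷ chosen₁) (a₁∈ ∷ a₃∈ ∷ chosen₂) chosen₃ =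
    step (edge⁻ (∩ˡ a₁∈)) (edge⁻ (∩ʳ a₁∈)) (edge x∈)
    (step (edge y∈) (edge z∈) (edge⁻ (∩ˡ a₃∈))
    (later-blocks-ladder (edge⁻ (∩ʳ a₃∈)) chosen₁ chosen₂ chosen₃))

  later-blocks-count : {rs xs as bs : List V} {a z : V} →
    Pointwise _∈_ xs (neighbourhoods rs) → Pointwise _∈_ as (bridges (z ∷ xs)) →
    Pointwise _∈_ bs (triples (a ∷ as)) → ∀ v →
    occ v (vertices (later-blocks rs xs as bs)) ≡ occ v rs + (occ v bs + (occ v as + occ v xs))
  later-blocks-count {[]}    [] [] [] v = refl
  later-blocks-count {r ∷ rs} {x ∷ y ∷ z ∷ xs} {a₄ ∷ a₁ ∷ a₃ ∷ as} {b ∷ bs}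
                     (_ ∷ _ ∷ _ ∷ chosen₁) (_ ∷ _ ∷ _ ∷ chosen₂) (_ ∷ chosen₃) v
    rewrite later-blocks-count chosen₁ chosen₂ chosen₃ v =
    later-block-count (δ v a₄) (δ v b) (δ v a₁) (δ v x) (δ v r) (δ v y) (δ v a₃) (δ v z)
                      (occ v rs) (occ v bs) (occ v as) (occ v xs)

  ladder-multiset : {r : V} {rs xs as bs : List V} →
    Pointwise _∈_ xs (neighbourhoods (r ∷ rs)) → Pointwise _∈_ as (bridges xs) →
    Pointwise _∈_ bs (corners as) →
    vertices (ladder (r ∷ rs) xs as bs) ≈ₘ (r ∷ rs) ++ bs ++ as ++ xs
  ladder-multiset {r} {rs} {x ∷ y ∷ z ∷ xs} {a₁ ∷ a₃ ∷ as} {bs}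
                  (_ ∷ _ ∷ _ ∷ chosen₁) (_ ∷ _ ∷ chosen₂) chosen₃ v
    rewrite occ-++³ v (r ∷ rs) bs (a₁ ∷ a₃ ∷ as) (x ∷ y ∷ z ∷ xs)
          | later-blocks-count chosen₁ chosen₂ chosen₃ v =
    first-block-count (δ v a₁) (δ v x) (δ v r) (δ v y) (δ v a₃) (δ v z)
                      (occ v rs) (occ v bs) (occ v as) (occ v xs)

  module Rounds (r₀ : V) (rs : List V) (rs-in-R : All (_∈ R) (r₀ ∷ rs))
                (size : suc (length rs) ≡ ∣ R ∣) where

    open Round

    round₁ : Round (neighbourhoods (r₀ ∷ rs)) []
    round₁ = greedy _ [] (distinct λ _ → z≤n)
                    (All.map (≤-trans (≤-reflexive budget)) (neighbourhoods-large rs-in-R))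
      where
      budget : length (neighbourhoods (r₀ ∷ rs)) ≡ 3 * ∣ R ∣
      budget = trans (length-neighbourhoods (r₀ ∷ rs)) (cong (3 *_) size)

    picks₁ : List V
    picks₁ = picks round₁

    picks₁-distinct : Distinct picks₁
    picks₁-distinct = distinct-++ˡ (new round₁)

    picks₁-N₁ : All N₁ picks₁
    picks₁-N₁ = neighbourhoods-N₁ rs-in-R (chosen round₁)

    length-picks₁ : length picks₁ ≡ 3 * suc (length rs)
    length-picks₁ = trans (Pointwise-length (chosen round₁)) (length-neighbourhoods (r₀ ∷ rs))

    length-bridges₁ : length (bridges picks₁) ≡ 2 + 3 * length rs
    length-bridges₁ =
      trans (length-bridges picks₁) (trans (cong pred length-picks₁) (pred-3* (length rs)))

    round₂ : Round (bridges picks₁) picks₁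
    round₂ = greedy _ picks₁ picks₁-distinct
                    (All.map (≤-trans budget) (bridges-large picks₁-N₁ picks₁-distinct))
      where
      budget : length picks₁ + length (bridges picks₁) ≤ 6 * ∣ R ∣
      budget = ≤-trans (≤-reflexive (cong₂ _+_ length-picks₁ length-bridges₁))
                       (budget₂ (length rs) size)

    picks₂ : List V
    picks₂ = picks round₂

    picks₂-N₂ : All N₂ picks₂
    picks₂-N₂ = bridges-N₂ picks₁-N₁ (chosen round₂)

    length-picks₂₁ : length (picks₂ ++ picks₁) ≡ (2 + 3 * length rs) + 3 * suc (length rs)
    length-picks₂₁ =
      trans (length-++ picks₂)
            (cong₂ _+_ (trans (Pointwise-length (chosen round₂)) length-bridges₁) length-picks₁)

    length-corners₂ : length (corners picks₂) ≡ length rs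
    length-corners₂ = length-corners (chosen round₁) (chosen round₂)

    round₃ : Round (corners picks₂) (picks₂ ++ picks₁)
    round₃ = greedy _ _ (new round₂)
                    (All.map (≤-trans budget) (corners-large picks₂-N₂ (distinct-++ˡ (new round₂))))
      where
      budget : length (picks₂ ++ picks₁) + length (corners picks₂) ≤ 7 * ∣ R ∣
      budget = ≤-trans (≤-reflexive (cong₂ _+_ length-picks₂₁ length-corners₂))
                       (budget₃ (length rs) size)

    picks₃ : List V
    picks₃ = picks round₃

    chosen-vertices : List V
    chosen-vertices = picks₃ ++ picks₂ ++ picks₁

    chosen-in-S : All (_∈ S) chosen-vertices
    chosen-in-S = ++⁺ (corners-S picks₂ (chosen round₃))
                      (++⁺ (All.map (N-⊆ F) picks₂-N₂) (All.map (N-⊆ F) picks₁-N₁))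

    chosen-count : length chosen-vertices ≡ 7 * ∣ R ∣ ∸ 2
    chosen-count = begin
      length (picks₃ ++ picks₂ ++ picks₁)
        ≡⟨ length-++ picks₃ ⟩
      length picks₃ + length (picks₂ ++ picks₁)
        ≡⟨ cong₂ _+_ (trans (Pointwise-length (chosen round₃)) length-corners₂) length-picks₂₁ ⟩
      length rs + ((2 + 3 * length rs) + 3 * suc (length rs))
        ≡⟨ picks-count (length rs) ⟩
      7 * suc (length rs) ∸ 2
        ≡⟨ cong (λ K → 7 * K ∸ 2) size ⟩
      7 * ∣ R ∣ ∸ 2 ∎
      where open ≡.≡-Reasoning

    the-ladder : List Rung
    the-ladder = ladder (r₀ ∷ rs) picks₁ picks₂ picks₃

    the-ladder-is-ladder : IsLadder the-ladder
    the-ladder-is-ladder = ladder-is-ladder (chosen round₁) (chosen round₂) (chosen round₃)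

    the-ladder-vertices : vertices the-ladder ≈ₘ (r₀ ∷ rs) ++ chosen-vertices
    the-ladder-vertices = ladder-multiset (chosen round₁) (chosen round₂) (chosen round₃)

lemma3p4 : ∀ {n} (F : Graph n) (S R : Subset n) →
    R ∩ S ≡ ⊥ → R ∪ S ≡ ⊤ → Nonempty R →
    (∀ r → r ∈ R → ∣ Γ F r S ∣ ≥ 3 * ∣ R ∣) →
    (∀ u v → N F (_∈ R) S u → N F (_∈ R) S v → u ≢ v →
      ∣ Γ F u S ∩ Γ F v S ∣ ≥ 6 * ∣ R ∣) →
    (∀ u v w → N F (N F (_∈ R) S) S u → N F (N F (_∈ R) S) S v →
      N F (N F (_∈ R) S) S w → u ≢ v → u ≢ w → v ≢ w →
      ∣ Γ F u S ∩ Γ F v S ∩ Γ F w S ∣ ≥ 7 * ∣ R ∣) →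
    ∃ λ m → Σ (Fin m ⊎ Fin m → Fin n) λ φ → LadderEmbedding F m φ ×
      Σ (Subset n) λ T → T ⊆ S × ∣ T ∣ ≡ 7 * ∣ R ∣ ∸ 2 ×
        (∀ v → InImage φ v ⇔ (v ∈ R ⊎ v ∈ T))
lemma3p4 F S R R∩S≡⊥ _ (r , r∈R) degree codegree₂ codegree₃
  with elements R | elements-∈ R | elements-distinct R | elements-size R
... | []      | listed | _           | _    with () ← Equivalence.from (listed r) r∈R
... | r₀ ∷ rs | listed | rs-distinct | size =
  length the-ladder , embed the-ladder ,
  ladder-embedding the-ladder-is-ladder ladder-distinct ,
  support chosen-vertices , chosen-⊆S , chosen-size , image
  where
  open Construction F S R degree codegree₂ codegree₃
  open Ladders F
  open Rounds r₀ rs (All.tabulate (λ {v} → Equivalence.to (listed v))) size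

  R-apart-S : ∀ {v} → v ∈ₗ r₀ ∷ rs → v ∈ₗ chosen-vertices → False
  R-apart-S {v} v∈R v∈S = ∉⊥ (subst (v ∈_) R∩S≡⊥ (x∈p∩q⁺ (Equivalence.to (listed v) v∈R ,
                                                            All.lookup chosen-in-S v∈S)))

  ladder-distinct : Distinct (vertices the-ladder)
  ladder-distinct = ≈ₘ-distinct the-ladder-vertices
                      (distinct-++ rs-distinct (Round.new round₃) R-apart-S)

  chosen-⊆S : support chosen-vertices ⊆ S
  chosen-⊆S {v} v∈ = All.lookup chosen-in-S (Equivalence.from (support-∈ chosen-vertices v) v∈)

  chosen-size : ∣ support chosen-vertices ∣ ≡ 7 * ∣ R ∣ ∸ 2
  chosen-size = trans (∣support∣ chosen-vertices (Round.new round₃)) chosen-count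

  image : ∀ v → InImage (embed the-ladder) v ⇔ (v ∈ R ⊎ v ∈ support chosen-vertices)
  image v = (listed v ⊎-⇔ support-∈ chosen-vertices v)
            ⇔-∘ (++-∈⇔ ⇔-∘ (≈ₘ-∈ the-ladder-vertices ⇔-∘ embed-image the-ladder v))
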